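{- The Leaf-Only Conversion procedure (described in the context) terminates on every admissible input, i.e., on every closed, eager and regular clausal tableau together with a set $S$ of pairwise non-complementary literals that occur as literal labels of nodes of the tableau.
   Context: A clausal tableau for a clausal formula $C$ is a finite ordered tree whose non-root nodes carry literal labels $\mathrm{lit}(N)$ (and possibly further labels, e.g. a side label) such that for each node with children, the disjunction of the children's labels is an instance of a clause of $C$. A node $N$ is closed if some ancestor $N'$ has $\mathrm{lit}(N')$ complementary to $\mathrm{lit}(N)$; a tableau is closed if all leaves are closed. A tableau is eager if no closed node is a descendant of another closed node; regular if no node has an ancestor with the same literal label; leaf-only for a set $S$ of pairwise non-complementary literals if no member of $S$ labels an inner node. A fresh copy of an ordered tree is an isomorphic tree with new nodes and edges carrying the same labels. Removal of Uneagerness: repeatedly select a closed inner node and remove the edges originating in it, until the tableau is eager. Removal of Irregularities: repeatedly select a node $N$ with an ancestor having the same literal label, and replace the edges originating in the parent of $N$ by the edges originating in $N$, until the tableau is regular. Leaf-Only Conversion. Input: a closed, eager, regular clausal tableau and a set $S$ of pairwise non-complementary literals occurring as literal labels in it. Repeat until the tableau is leaf-only for $S$: (1) let $N$ be the first inner node, in pre-order traversal, whose literal label is in $S$, and let $N'$ be its parent; (2) create a fresh copy $U$ of the subtree rooted at $N'$ and in $U$ remove the edges originating in the node corresponding to $N$; (3) remove the edges originating in $N'$ and replace them with the edges originating in $N$; (4) for each leaf descendant $M$ of $N'$ with $\mathrm{lit}(M)$ complementary to $\mathrm{lit}(N)$, create a fresh copy $U'$ of $U$ and change the origin of the edges originating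 in the root of $U'$ to $M$; (5) apply Removal of Uneagerness and then Removal of Irregularities. -}

module Defs where

open import Data.Nat using (ℕ; zero; suc; _<_)
open import Data.Bool using (Bool; not)
open import Data.List using (List; []; _∷_; _++_; map)
open import Data.List.Membership.Propositional using (_∈_; _∉_)
open import Data.List.Relation.Binary.Pointwise using (Pointwise)
open import Data.Maybe using (Maybe; just; nothing)
open import Data.Sum using (_⊎_)
open import Data.Product using (Σ; ∃; ∃-syntax; _×_; _,_)
open import Relation.Binary.PropositionalEquality using (_≡_; _≢_)
open import Relation.Nullary using (¬_)
open import Induction.WellFounded using (Acc)

data Term : Set where
  var : ℕ → Term
  fn  : ℕ → List Term → Term

record Atom : Set where
  constructor atom
  field
    pred : ℕ
    args : List Term

record Lit : Set where
  constructor lit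
  field
    sign : Bool                        -- true = positive, false = negated
    at   : Atom

neg : Lit → Lit
neg (lit b a) = lit (not b) a

Complementary : Lit → Lit → Set
Complementary l l' = l' ≡ neg l

Subst : Set
Subst = ℕ → Term

mutual
  substT : Subst → Term → Term
  substT σ (var x)   = σ x
  substT σ (fn f ts) = fn f (substTs σ ts)

  substTs : Subst → List Term → List Term
  substTs σ []       = []
  substTs σ (t ∷ ts) = substT σ t ∷ substTs σ ts

substL : Subst → Lit → Lit
substL σ (lit b (atom p ts)) = lit b (atom p (substTs σ ts))

Clause : Set
Clause = List Lit                      -- a clause is a disjunction of literals

ClausalFormula : Set
ClausalFormula = List Clause           -- a conjunction of clauses

-- Finite ordered trees; the root carries no literal (label nothing),
-- every other node carries a literal label (just l).

data Tree : Set where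
  node : Maybe Lit → List Tree → Tree

-- positions: paths of child indices from the root
Path : Set
Path = List ℕ

nth : {A : Set} → List A → ℕ → Maybe A
nth []       _       = nothing
nth (x ∷ xs) zero    = just x
nth (x ∷ xs) (suc i) = nth xs i

updN : {A : Set} → ℕ → (A → A) → List A → List A
updN _       f []       = []
updN zero    f (x ∷ xs) = f x ∷ xs
updN (suc i) f (x ∷ xs) = x ∷ updN i f xs

sub : Tree → Path → Maybe Tree
sub t [] = just t
sub (node _ cs) (i ∷ p) with nth cs i
... | nothing = nothing
... | just c  = sub c p

upd : Path → (Tree → Tree) → Tree → Tree
upd []      f t           = f t
upd (i ∷ p) f (node l cs) = node l (updN i (upd p f) cs)

label : Tree → Maybe Lit
label (node l _) = l

StrictPrefix : Path → Path → Set
StrictPrefix q p = ∃[ i ] ∃[ r ] (p ≡ q ++ (i ∷ r))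

-- pre-order: q is visited strictly before p
_≺_ : Path → Path → Set
q ≺ p = StrictPrefix q p
      ⊎ (∃[ pre ] ∃[ i ] ∃[ j ] ∃[ r ] ∃[ r' ]
            (i < j × q ≡ pre ++ (i ∷ r) × p ≡ pre ++ (j ∷ r')))

LitAt : Tree → Path → Lit → Set
LitAt t p l = ∃[ cs ] (sub t p ≡ just (node (just l) cs))

Inner : Tree → Path → Set
Inner t p = ∃[ l ] ∃[ c ] ∃[ cs ] (sub t p ≡ just (node l (c ∷ cs)))

Leaf : Tree → Path → Set
Leaf t p = ∃[ l ] (sub t p ≡ just (node l []))

InstanceOfClause : ClausalFormula → List (Maybe Lit) → Set
InstanceOfClause C ls = ∃[ c ] ∃[ σ ] (c ∈ C × map (λ l → just (substL σ l)) c ≡ ls)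

ClausalTableau : ClausalFormula → Tree → Set
ClausalTableau C t =
  label t ≡ nothing ×
  (∀ p l c cs → sub t p ≡ just (node l (c ∷ cs)) → InstanceOfClause C (map label (c ∷ cs)))

ClosedNode : Tree → Path → Set
ClosedNode t p = ∃[ q ] ∃[ l' ] ∃[ l ]
  (StrictPrefix q p × LitAt t q l' × LitAt t p l × Complementary l' l)

ClosedTableau : Tree → Set
ClosedTableau t = ∀ p → Leaf t p → ClosedNode t p

Eager : Tree → Set
Eager t = ∀ q p → StrictPrefix q p → ClosedNode t q → ¬ ClosedNode t p

Regular : Tree → Set
Regular t = ∀ q p l → StrictPrefix q p → LitAt t q l → ¬ LitAt t p l

LeafOnly : List Lit → Tree → Set
LeafOnly S t = ∀ p l → Inner t p → LitAt t p l → l ∉ S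

PairwiseNonComplementary : List Lit → Set
PairwiseNonComplementary S = ∀ l l' → l ∈ S → l' ∈ S → ¬ Complementary l l'

OccurIn : List Lit → Tree → Set
OccurIn S t = ∀ l → l ∈ S → ∃[ p ] LitAt t p l

UneagerStep : Tree → Tree → Set
UneagerStep t t' = ∃[ p ] ∃[ l ] ∃[ c ] ∃[ cs ]
  (sub t p ≡ just (node l (c ∷ cs)) × ClosedNode t p ×
   t' ≡ upd p (λ _ → node l []) t)

-- one step of Removal of Irregularities: N = child i of the node at p
IrregStep : Tree → Tree → Set
IrregStep t t' = ∃[ p ] ∃[ i ] ∃[ lP ] ∃[ cs ] ∃[ lN ] ∃[ ds ]
  ((∃[ q ] ∃[ l ] (StrictPrefix q (p ++ (i ∷ [])) × LitAt t q l × LitAt t (p ++ (i ∷ [])) l)) ×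
   sub t p ≡ just (node lP cs) × nth cs i ≡ just (node lN ds) ×
   t' ≡ upd p (λ _ → node lP ds) t)

-- Graft l us t t' : t' arises from t by giving every leaf whose literal
-- is complementary to l the children us (fresh copies of U's root edges).
data Graft (l : Lit) (us : List Tree) : Tree → Tree → Set where
  leaf-comp  : ∀ m → Complementary l m → Graft l us (node (just m) []) (node (just m) us)
  leaf-other : ∀ m → (∀ m' → m ≡ just m' → ¬ Complementary l m') →
               Graft l us (node m []) (node m [])
  inner      : ∀ m c cs cs' → Pointwise (Graft l us) (c ∷ cs) cs' →
               Graft l us (node m (c ∷ cs)) (node m cs')

FirstInS : List Lit → Tree → Path → Set
FirstInS S t p =
  Inner t p × (∃[ l ] (LitAt t p l × l ∈ S)) ×
  (∀ q → q ≺ p → Inner t q → ∀ l → LitAt t q l → l ∉ S)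

-- steps (1)-(4) of Leaf-Only Conversion
ConvStep : List Lit → Tree → Tree → Set
ConvStep S t t' = ∃[ p ] ∃[ i ] ∃[ lP ] ∃[ cs ] ∃[ l ] ∃[ ds ] ∃[ ds' ]
  (FirstInS S t (p ++ (i ∷ [])) ×
   sub t p ≡ just (node lP cs) ×                       -- N' = node at p
   nth cs i ≡ just (node (just l) ds) ×                -- N = its i-th child
   -- U = node lP (updN i (λ _ → node (just l) []) cs); its root edges are grafted
   Pointwise (Graft l (updN i (λ _ → node (just l) []) cs)) ds ds' ×
   t' ≡ upd p (λ _ → node lP ds') t)

data Phase : Set where
  convPhase uneagerPhase irregPhase : Phase

State : Set
State = Phase × Tree

data Step (S : List Lit) : State → State → Set where
  conv      : ∀ t t' → ConvStep S t t' → Step S (convPhase , t) (uneagerPhase , t')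
  uneager   : ∀ t t' → UneagerStep t t' → Step S (uneagerPhase , t) (uneagerPhase , t')
  uneagerOk : ∀ t → Eager t → Step S (uneagerPhase , t) (irregPhase , t)
  irreg     : ∀ t t' → IrregStep t t' → Step S (irregPhase , t) (irregPhase , t')
  irregOk   : ∀ t → Regular t → Step S (irregPhase , t) (convPhase , t)
  -- in convPhase with LeafOnly S t there is no step: the procedure halts

Terminates : List Lit → State → Set
Terminates S s = Acc (λ s' s₀ → Step S s₀ s') s

-- Give every node the level "number of literals of S that label no live inner node below it",
-- where an inner node is live unless its literal is already closed by the branch above it, and
-- measure a tableau by the vector counting its nodes per level, compared lexicographically
-- (low levels weigh most).  Removing uneagerness or irregularities deletes nodes and creates no
-- live S-literal.  In a conversion step with N labelled l, either l is closed at N, and the step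
-- is a contraction exactly like the removal of an irregularity, or l stops being live below N′:
-- N itself disappears, the grafted copies sit below leaves labelled ¬l, where l is closed, and
-- the new inner nodes labelled ¬l are not in S.  Then the level of N′ goes up, and every node of
-- the new subtree has a level above the old level of N′.  Together with the phase as a last
-- lexicographic component, every step of the procedure decreases a well-founded measure.
module Submission where

open import Defs
open import Data.Bool.Properties using (not-involutive) renaming (_≟_ to _≟ᴮ_)
open import Data.List using (List; []; _∷_; _++_; length; filter; fromMaybe)
open import Data.List.Properties
  using (∷-dec; length-filter; ++-assoc; ++-identityʳ; ++-conicalʳ; ∷-injective)
open import Data.List.Membership.Propositional using (_∈_; _∉_; lose)
open import Data.List.Membership.Propositional.Properties using (∈-++⁻; ∈-++⁺ˡ; ∈-++⁺ʳ)
open import Data.List.Relation.Binary.Pointwise using (Pointwise; []; _∷_)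
open import Data.List.Relation.Binary.Subset.Propositional using (_⊆_)
open import Data.List.Relation.Unary.All using (All; []; _∷_)
open import Data.List.Relation.Unary.Any as Any using (Any; here; there)
open import Data.Maybe using (Maybe; just; nothing)
import Data.Maybe.Relation.Unary.All as Maybe
open import Data.Nat using (ℕ; zero; suc; _+_; _<_; _≤_; z≤n; s≤s; z<s)
open import Data.Nat.Induction using (<-wellFounded)
open import Data.Nat.Properties as ℕ
  using (≤-refl; ≤-antisym; m≤n⇒m≤1+n; +-identityʳ; +-comm; +-mono-<; +-monoˡ-<; +-monoʳ-<)
  renaming (_≟_ to _≟ᴺ_)
open import Data.Product using (∃-syntax; _×_; _,_; proj₁; proj₂)
open import Data.Product.Relation.Binary.Lex.Strict using (×-Lex; ×-wellFounded)
open import Data.Sum using (_⊎_; inj₁; inj₂)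
open import Data.Unit using (⊤; tt)
open import Data.Vec using (Vec; []; _∷_; zipWith; replicate)
open import Data.Vec.Properties using (zipWith-identityʳ; zipWith-comm)
open import Data.Vec.Relation.Binary.Lex.Core {A = ℕ} using (Lex; map-P)
open import Data.Vec.Relation.Binary.Lex.Strict as Lex using (Lex-<; Lex-≤; base; this; next)
import Data.Vec.Relation.Binary.Pointwise.Inductive as Pointwise
open import Induction.WellFounded using (WellFounded; Acc; acc)
open import Relation.Binary.Definitions using (DecidableEquality)
open import Relation.Binary.PropositionalEquality
  using (_≡_; _≢_; refl; sym; trans; cong; cong₂; subst; subst₂; respʳ; resp₂; isEquivalence)
open import Relation.Binary.Structures using (IsEquivalence; IsPartialEquivalence)
open import Relation.Nullary using (¬_; Dec; yes; no; contradiction)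
open import Relation.Nullary.Decidable using (map′; _×-dec_; ¬?)
open import Relation.Unary using (Pred; Decidable)

Counts : ℕ → Set
Counts = Vec ℕ

infix 4 _<ᶜ_ _≤ᶜ_
infixl 6 _⊕_

_<ᶜ_ _≤ᶜ_ : ∀ {k} → Counts k → Counts k → Set
_<ᶜ_ = Lex-< _≡_ _<_
_≤ᶜ_ = Lex-≤ _≡_ _<_

_⊕_ : ∀ {k} → Counts k → Counts k → Counts k
_⊕_ = zipWith _+_

0ᶜ : ∀ {k} → Counts k
0ᶜ = replicate _ 0

-- the p-th unit vector; 0ᶜ when p is out of range
δ : ∀ {k} → ℕ → Counts k
δ {zero}  _       = []
δ {suc k} zero    = 1 ∷ 0ᶜ
δ {suc k} (suc p) = 0 ∷ δ p

<ᶜ-wellFounded : ∀ {k} → WellFounded (_<ᶜ_ {k})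
<ᶜ-wellFounded = Lex.<-wellFounded trans (respʳ _<_) <-wellFounded

module _ {k : ℕ} {a b c : Counts k} where
  private
    ≡-isPartialEquivalence : IsPartialEquivalence {A = ℕ} _≡_
    ≡-isPartialEquivalence = IsEquivalence.isPartialEquivalence isEquivalence

  <ᶜ-≤ᶜ-trans : a <ᶜ b → b ≤ᶜ c → a <ᶜ c
  <ᶜ-≤ᶜ-trans = Lex.<-transˡ ≡-isPartialEquivalence (resp₂ _<_) ℕ.<-trans

  ≤ᶜ-trans : a ≤ᶜ b → b ≤ᶜ c → a ≤ᶜ c
  ≤ᶜ-trans = Lex.≤-trans ≡-isPartialEquivalence (resp₂ _<_) ℕ.<-trans

≤ᶜ-refl : ∀ {k} {a : Counts k} → a ≤ᶜ a
≤ᶜ-refl = Lex.≤-refl (Pointwise.refl refl)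

⊕-mono : ∀ {P Q k} {a b c d : Counts k} →
         Lex P _≡_ _<_ a b → Lex Q _≡_ _<_ c d → Lex (P × Q) _≡_ _<_ (a ⊕ c) (b ⊕ d)
⊕-mono (base p)       (base q)       = base (p , q)
⊕-mono (this a<b _)   (this c<d _)   = this (+-mono-< a<b c<d) refl
⊕-mono (this a<b _)   (next refl _)  = this (+-monoˡ-< _ a<b) refl
⊕-mono (next refl _)  (this c<d _)   = this (+-monoʳ-< _ c<d) refl
⊕-mono (next refl ab) (next refl cd) = next refl (⊕-mono ab cd)

⊕-mono-≤ : ∀ {k} {a b c d : Counts k} → a ≤ᶜ b → c ≤ᶜ d → a ⊕ c ≤ᶜ b ⊕ d
⊕-mono-≤ ab cd = map-P proj₁ (⊕-mono ab cd)

⊕-mono-<-≤ : ∀ {k} {a b c d : Counts k} → a <ᶜ b → c ≤ᶜ d → a ⊕ c <ᶜ b ⊕ d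
⊕-mono-<-≤ ab cd = map-P proj₁ (⊕-mono ab cd)

⊕-mono-≤-< : ∀ {k} {a b c d : Counts k} → a ≤ᶜ b → c <ᶜ d → a ⊕ c <ᶜ b ⊕ d
⊕-mono-≤-< ab cd = map-P proj₂ (⊕-mono ab cd)

⊕-comm : ∀ {k} (a b : Counts k) → a ⊕ b ≡ b ⊕ a
⊕-comm = zipWith-comm +-comm

0ᶜ-minimum : ∀ {k} (a : Counts k) → 0ᶜ ≤ᶜ a
0ᶜ-minimum []          = base tt
0ᶜ-minimum (zero  ∷ a) = next refl (0ᶜ-minimum a)
0ᶜ-minimum (suc _ ∷ _) = this z<s refl

≤ᶜ-⊕ʳ : ∀ {k} (a b : Counts k) → a ≤ᶜ a ⊕ b
≤ᶜ-⊕ʳ a b = subst (_≤ᶜ a ⊕ b) (zipWith-identityʳ +-identityʳ a) (⊕-mono-≤ ≤ᶜ-refl (0ᶜ-minimum b))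

≤ᶜ-⊕ˡ : ∀ {k} (a b : Counts k) → a ≤ᶜ b ⊕ a
≤ᶜ-⊕ˡ a b = subst (a ≤ᶜ_) (⊕-comm a b) (≤ᶜ-⊕ʳ a b)

<ᶜ-⊕ˡ : ∀ {k} {b : Counts k} (a : Counts k) → 0ᶜ <ᶜ b → a <ᶜ b ⊕ a
<ᶜ-⊕ˡ {b = b} a 0<b =
  subst₂ _<ᶜ_ (zipWith-identityʳ +-identityʳ a) (⊕-comm a b) (⊕-mono-≤-< ≤ᶜ-refl 0<b)

0ᶜ<ᶜδ : ∀ {k p} → p < k → 0ᶜ <ᶜ δ {k} p
0ᶜ<ᶜδ {suc k} {zero}  _         = this z<s refl
0ᶜ<ᶜδ {suc k} {suc p} (s≤s p<k) = next refl (0ᶜ<ᶜδ p<k)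

δ-antitone : ∀ {k p q} → p ≤ q → δ {k} q ≤ᶜ δ p
δ-antitone {zero}                    _         = base tt
δ-antitone {suc k} {zero}  {zero}    _         = ≤ᶜ-refl
δ-antitone {suc k} {zero}  {suc q}   _         = this z<s refl
δ-antitone {suc k} {suc p} {suc q}   (s≤s p≤q) = next refl (δ-antitone p≤q)

ZeroBelow : ∀ {k} → ℕ → Counts k → Set
ZeroBelow zero    _       = ⊤
ZeroBelow (suc p) []      = ⊤
ZeroBelow (suc p) (x ∷ a) = x ≡ 0 × ZeroBelow p a

ZeroBelow-0ᶜ : ∀ {k} p → ZeroBelow p (0ᶜ {k})
ZeroBelow-0ᶜ         zero    = tt
ZeroBelow-0ᶜ {zero}  (suc p) = tt
ZeroBelow-0ᶜ {suc k} (suc p) = refl , ZeroBelow-0ᶜ p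

ZeroBelow-⊕ : ∀ {k p} (a b : Counts k) → ZeroBelow p a → ZeroBelow p b → ZeroBelow p (a ⊕ b)
ZeroBelow-⊕ {p = zero}  _       _       _           _           = tt
ZeroBelow-⊕ {p = suc p} []      []      _           _           = tt
ZeroBelow-⊕ {p = suc p} (_ ∷ a) (_ ∷ b) (refl , za) (refl , zb) = refl , ZeroBelow-⊕ a b za zb

ZeroBelow-δ : ∀ {k p q} → p ≤ q → ZeroBelow p (δ {k} q)
ZeroBelow-δ {p = zero}                 _         = tt
ZeroBelow-δ {zero}  {suc p}            _         = tt
ZeroBelow-δ {suc k} {suc p} {suc q}    (s≤s p≤q) = refl , ZeroBelow-δ p≤q

ZeroBelow-anti : ∀ {k p q} (a : Counts k) → p ≤ q → ZeroBelow q a → ZeroBelow p a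
ZeroBelow-anti _       z≤n       _        = tt
ZeroBelow-anti []      (s≤s _)   _        = tt
ZeroBelow-anti (_ ∷ a) (s≤s p≤q) (e , za) = e , ZeroBelow-anti a p≤q za

ZeroBelow⇒<ᶜδ : ∀ {k p} (a : Counts k) → p < k → ZeroBelow (suc p) a → a <ᶜ δ p
ZeroBelow⇒<ᶜδ {p = zero}  (_ ∷ _) _         (refl , _)  = this z<s refl
ZeroBelow⇒<ᶜδ {p = suc p} (_ ∷ a) (s≤s p<k) (refl , za) = next refl (ZeroBelow⇒<ᶜδ a p<k za)

module _ {a p} {A : Set a} {P Q : Pred A p} (P? : Decidable P) (Q? : Decidable Q) where

  length-filter-mono : ∀ xs → (∀ {x} → x ∈ xs → P x → Q x) →
                       length (filter P? xs) ≤ length (filter Q? xs)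
  length-filter-mono []       _   = z≤n
  length-filter-mono (x ∷ xs) P⇒Q with P? x | Q? x
  ... | yes px | yes _  = s≤s (length-filter-mono xs (λ x∈ → P⇒Q (there x∈)))
  ... | yes px | no ¬qx = contradiction (P⇒Q (here refl) px) ¬qx
  ... | no _   | yes _  = m≤n⇒m≤1+n (length-filter-mono xs (λ x∈ → P⇒Q (there x∈)))
  ... | no _   | no _   = length-filter-mono xs (λ x∈ → P⇒Q (there x∈))

  length-filter-strict : ∀ xs → (∀ {x} → x ∈ xs → P x → Q x) → ∀ {z} → z ∈ xs → Q z → ¬ P z →
                         length (filter P? xs) < length (filter Q? xs)
  length-filter-strict (x ∷ xs) P⇒Q (here refl) qz ¬pz with P? x | Q? x
  ... | yes px | _      = contradiction px ¬pz
  ... | no _   | yes _  = s≤s (length-filter-mono xs (λ x∈ → P⇒Q (there x∈)))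
  ... | no _   | no ¬qz = contradiction qz ¬qz
  length-filter-strict (x ∷ xs) P⇒Q (there z∈) qz ¬pz with P? x | Q? x
  ... | yes px | yes _  = s≤s (length-filter-strict xs (λ x∈ → P⇒Q (there x∈)) z∈ qz ¬pz)
  ... | yes px | no ¬qx = contradiction (P⇒Q (here refl) px) ¬qx
  ... | no _   | yes _  = m≤n⇒m≤1+n (length-filter-strict xs (λ x∈ → P⇒Q (there x∈)) z∈ qz ¬pz)
  ... | no _   | no _   = length-filter-strict xs (λ x∈ → P⇒Q (there x∈)) z∈ qz ¬pz

mutual
  _≟ᵀ_ : DecidableEquality Term
  var x   ≟ᵀ var y   = map′ (cong var) (λ { refl → refl }) (x ≟ᴺ y)
  var _   ≟ᵀ fn _ _  = no λ ()
  fn _ _  ≟ᵀ var _   = no λ ()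
  fn f ts ≟ᵀ fn g us =
    map′ (λ { (refl , refl) → refl }) (λ { refl → refl , refl }) (f ≟ᴺ g ×-dec ts ≟ᵀˢ us)

  _≟ᵀˢ_ : DecidableEquality (List Term)
  []       ≟ᵀˢ []       = yes refl
  []       ≟ᵀˢ (_ ∷ _)  = no λ ()
  (_ ∷ _)  ≟ᵀˢ []       = no λ ()
  (t ∷ ts) ≟ᵀˢ (u ∷ us) = ∷-dec (t ≟ᵀ u) (ts ≟ᵀˢ us)

_≟ˡ_ : DecidableEquality Lit
lit b (atom p ts) ≟ˡ lit b′ (atom p′ ts′) =
  map′ (λ { (refl , refl , refl) → refl }) (λ { refl → refl , refl , refl })
       (b ≟ᴮ b′ ×-dec p ≟ᴺ p′ ×-dec ts ≟ᵀˢ ts′)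

open import Data.List.Membership.DecPropositional _≟ˡ_ using (_∈?_)

neg-involutive : ∀ l → neg (neg l) ≡ l
neg-involutive (lit b a) = cong (λ b → lit b a) (not-involutive b)

nth-∈ : ∀ {A : Set} (xs : List A) i {x} → nth xs i ≡ just x → x ∈ xs
nth-∈ (_ ∷ _)  zero    refl = here refl
nth-∈ (_ ∷ xs) (suc i) eq   = there (nth-∈ xs i eq)

Any-updN-const⁻ : ∀ {A : Set} {P : A → Set} i {y} xs → Any P (updN i (λ _ → y) xs) → Any P xs ⊎ P y
Any-updN-const⁻ zero    (_ ∷ _)  (here py)   = inj₂ py
Any-updN-const⁻ zero    (_ ∷ _)  (there pxs) = inj₁ (there pxs)
Any-updN-const⁻ (suc i) (_ ∷ _)  (here px)   = inj₁ (here px)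
Any-updN-const⁻ (suc i) (_ ∷ xs) (there pxs) with Any-updN-const⁻ i xs pxs
... | inj₁ pxs′ = inj₁ (there pxs′)
... | inj₂ py   = inj₂ py

sub-step : ∀ m cs j {w} r → nth cs j ≡ just w → sub (node m cs) (j ∷ r) ≡ sub w r
sub-step m cs j r eq with nth cs j
sub-step m cs j r refl | just _ = refl

sub-++ : ∀ t p r {u} → sub t p ≡ just u → sub t (p ++ r) ≡ sub u r
sub-++ t           []      r refl = refl
sub-++ (node m cs) (i ∷ p) r eq with nth cs i
... | just w = sub-++ w p r eq

sub-child : ∀ t p {m cs} i {w} → sub t p ≡ just (node m cs) → nth cs i ≡ just w →
            sub t (p ++ i ∷ []) ≡ just w
sub-child t p {m} {cs} i eq eqᵢ = trans (sub-++ t p (i ∷ []) eq) (sub-step m cs i [] eqᵢ)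

prefix-of-snoc : ∀ (p : Path) {i} q {j : ℕ} {r} → p ++ i ∷ [] ≡ q ++ j ∷ r → ∃[ r′ ] p ≡ q ++ r′
prefix-of-snoc p       []      _  = p , refl
prefix-of-snoc []      (k ∷ q) eq with () ← ++-conicalʳ q _ (sym (∷-injective eq .proj₂))
prefix-of-snoc (x ∷ p) (k ∷ q) eq with ∷-injective eq
... | refl , eq′ with prefix-of-snoc p q eq′
...   | r′ , refl = r′ , refl

StrictPrefix-below : ∀ q r j s → StrictPrefix q ((q ++ r) ++ j ∷ s)
StrictPrefix-below q []      j s = j , s , cong (_++ j ∷ s) (++-identityʳ q)
StrictPrefix-below q (k ∷ r) j s = k , r ++ j ∷ s , ++-assoc q (k ∷ r) (j ∷ s)

data AllLabels (P : Lit → Set) : Tree → Set where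
  node : ∀ {m cs} → Maybe.All P m → All (AllLabels P) cs → AllLabels P (node m cs)

mutual
  AllLabels-fromLitAt : ∀ {P} t → (∀ r {y} → LitAt t r y → P y) → AllLabels P t
  AllLabels-fromLitAt (node nothing  cs) P-at =
    node Maybe.nothing (AllLabels-children cs (λ j r → P-at (j ∷ r)))
  AllLabels-fromLitAt (node (just y) cs) P-at =
    node (Maybe.just (P-at [] (cs , refl))) (AllLabels-children cs (λ j r → P-at (j ∷ r)))

  -- sub below the root ignores its label, so node nothing cs stands for every node m cs
  AllLabels-children : ∀ {P} cs → (∀ j r {y} → LitAt (node nothing cs) (j ∷ r) y → P y) →
                       All (AllLabels P) cs
  AllLabels-children []       P-at = []
  AllLabels-children (c ∷ cs) P-at =
    AllLabels-fromLitAt c (P-at zero) ∷ AllLabels-children cs (λ j → P-at (suc j))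

Regular⇒absent-below : ∀ {t y m ds} q r {p} → Regular t → LitAt t q y → p ≡ q ++ r →
                       sub t p ≡ just (node m ds) → All (AllLabels (_≢ y)) ds
Regular⇒absent-below {t} {y} {m} {ds} q r reg atq refl eq =
  AllLabels-children ds λ { j s (cs′ , eqₛ) refl →
    reg q ((q ++ r) ++ j ∷ s) y (StrictPrefix-below q r j s) atq
        (cs′ , trans (sub-++ t (q ++ r) (j ∷ s) eq) eqₛ) }

extend : Maybe Lit → List Lit → List Lit
extend m c = fromMaybe m ++ c

branch : List Lit → Tree → Path → List Lit
branch c t           []      = c
branch c (node m cs) (i ∷ p) with nth cs i
... | nothing = c
... | just w  = branch (extend m c) w p

branch-⊇ : ∀ c t p → c ⊆ branch c t p
branch-⊇ c t           []      = λ y∈ → y∈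
branch-⊇ c (node m cs) (i ∷ p) with nth cs i
... | nothing = λ y∈ → y∈
... | just w  = λ y∈ → branch-⊇ (extend m c) w p (∈-++⁺ʳ (fromMaybe m) y∈)

∈-branch⁺ : ∀ c t q r {y lP cs} → LitAt t q y → sub t (q ++ r) ≡ just (node lP cs) →
            y ∈ extend lP (branch c t (q ++ r))
∈-branch⁺ c (node _ _)  []      []      (_ , refl) refl = here refl
∈-branch⁺ c (node _ cs) []      (j ∷ r) (_ , refl) eq with nth cs j
... | just w = ∈-++⁺ʳ _ (branch-⊇ (_ ∷ c) w r (here refl))
∈-branch⁺ c (node m cs) (k ∷ q) r       atq        eq with nth cs k
... | just w = ∈-branch⁺ (extend m c) w q r atq eq

∈-branch⁻ : ∀ c t p {y lP cs} → sub t p ≡ just (node lP cs) → y ∈ extend lP (branch c t p) →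
            y ∈ c ⊎ ∃[ q ] ∃[ r ] (p ≡ q ++ r × LitAt t q y)
∈-branch⁻ c (node lP cs) [] refl y∈ with ∈-++⁻ (fromMaybe lP) y∈
∈-branch⁻ c (node (just y) cs) [] refl y∈ | inj₁ (here refl) = inj₂ ([] , [] , refl , cs , refl)
... | inj₂ y∈c = inj₁ y∈c
∈-branch⁻ c (node m cs) (j ∷ p) eq y∈ with nth cs j in eqⱼ
... | just w with ∈-branch⁻ (extend m c) w p eq y∈
...   | inj₂ (q , r , refl , cs′ , eqq) =
  inj₂ (j ∷ q , r , refl , cs′ , trans (sub-step m cs j q eqⱼ) eqq)
...   | inj₁ y∈mc with ∈-++⁻ (fromMaybe m) y∈mc
...     | inj₂ y∈c = inj₁ y∈c
∈-branch⁻ c (node (just y) cs) (j ∷ p) eq y∈ | just w | inj₁ _ | inj₁ (here refl) =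
  inj₂ ([] , j ∷ p , refl , cs , refl)

-- c lists the literals on the branch above t
data Live (x : Lit) : List Lit → Tree → Set where
  here  : ∀ {c d ds} → neg x ∉ c → Live x c (node (just x) (d ∷ ds))
  there : ∀ {c m cs} → Any (Live x (extend m c)) cs → Live x c (node m cs)

mutual
  live? : ∀ x c t → Dec (Live x c t)
  live? x c (node m cs) with lives? x (extend m c) cs
  ... | yes p = yes (there p)
  live? x c (node nothing cs)        | no ¬p = no λ { (there p) → ¬p p }
  live? x c (node (just y) [])       | no ¬p = no λ { (there ()) }
  live? x c (node (just y) (d ∷ ds)) | no ¬p with y ≟ˡ x | neg x ∈? c
  ... | yes refl | no ∉c  = yes (here ∉c)
  ... | yes refl | yes ∈c = no λ { (here ∉c) → ∉c ∈c ; (there p) → ¬p p }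
  ... | no y≢x   | _      = no λ { (here _) → y≢x refl ; (there p) → ¬p p }

  lives? : ∀ x c ts → Dec (Any (Live x c) ts)
  lives? x c []       = no λ ()
  lives? x c (t ∷ ts) with live? x c t | lives? x c ts
  ... | yes p | _     = yes (here p)
  ... | no _  | yes q = yes (there q)
  ... | no ¬p | no ¬q = no λ { (here p) → ¬p p ; (there q) → ¬q q }

ClosureTransfer : (Lit → Set) → List Lit → List Lit → Set
ClosureTransfer Q c c′ = ∀ {x} → Q x → neg x ∈ c → neg x ∈ c′

transfer-extend : ∀ {Q c c′} m → ClosureTransfer Q c c′ → ClosureTransfer Q (extend m c) (extend m c′)
transfer-extend m tr qx ∈mc with ∈-++⁻ (fromMaybe m) ∈mc
... | inj₁ ∈m = ∈-++⁺ˡ ∈m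
... | inj₂ ∈c = ∈-++⁺ʳ (fromMaybe m) (tr qx ∈c)

mutual
  Live-transport : ∀ {Q c c′ x t} → ClosureTransfer Q c′ c → AllLabels Q t → Live x c t → Live x c′ t
  Live-transport tr (node (Maybe.just qx) _) (here ∉c) = here (λ ∈c′ → ∉c (tr qx ∈c′))
  Live-transport tr (node {m = m} _ alls)    (there p) =
    there (Lives-transport (transfer-extend m tr) alls p)

  Lives-transport : ∀ {Q c c′ x ts} → ClosureTransfer Q c′ c → All (AllLabels Q) ts →
                    Any (Live x c) ts → Any (Live x c′) ts
  Lives-transport tr (all ∷ _) (here p)  = here (Live-transport tr all p)
  Lives-transport tr (_ ∷ alls) (there p) = there (Lives-transport tr alls p)

Live-antitone : ∀ {c c′ x t} → c ⊆ c′ → Live x c′ t → Live x c t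
Live-antitone {t = t} c⊆c′ =
  Live-transport {Q = λ _ → ⊤} (λ _ → c⊆c′) (AllLabels-fromLitAt t (λ _ _ → tt))

mutual
  Live⇒open : ∀ {x c t} → Live x c t → neg x ∉ c
  Live⇒open (here ∉c)            = ∉c
  Live⇒open (there {m = m} p) ∈c = Lives⇒open p (∈-++⁺ʳ (fromMaybe m) ∈c)

  Lives⇒open : ∀ {x c ts} → Any (Live x c) ts → neg x ∉ c
  Lives⇒open (here p)  = Live⇒open p
  Lives⇒open (there p) = Lives⇒open p

mutual
  Graft-identity : ∀ {l us T T′} → Graft l us T T′ → AllLabels (_≢ neg l) T → T′ ≡ T
  Graft-identity (leaf-comp m comp)     (node (Maybe.just m≢) _) = contradiction comp m≢
  Graft-identity (leaf-other m _)       _                        = refl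
  Graft-identity (inner m _ _ _ grafts) (node _ alls)            = cong (node m) (Grafts-identity grafts alls)

  Grafts-identity : ∀ {l us ts ts′} → Pointwise (Graft l us) ts ts′ → All (AllLabels (_≢ neg l)) ts →
                    ts′ ≡ ts
  Grafts-identity []               []           = refl
  Grafts-identity (graft ∷ grafts) (all ∷ alls) =
    cong₂ _∷_ (Graft-identity graft all) (Grafts-identity grafts alls)

extend-⊆-∷ : ∀ {l co cn} m → co ⊆ l ∷ cn → extend m co ⊆ l ∷ extend m cn
extend-⊆-∷ m co⊆ y∈ with ∈-++⁻ (fromMaybe m) y∈
... | inj₁ y∈m = there (∈-++⁺ˡ y∈m)
... | inj₂ y∈co with co⊆ y∈co
...   | here y≡l   = here y≡l
...   | there y∈cn = there (∈-++⁺ʳ (fromMaybe m) y∈cn)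

-- Grafting copies of us below the leaves labelled neg l, in a branch that has lost l, creates no
-- live S-literal apart from those us provides: the grafted leaves become inner nodes labelled
-- neg l ∉ S, and dropping l from the branch reopens only neg l.
module Grafting (S : List Lit) (pnc : PairwiseNonComplementary S) {l} (l∈S : l ∈ S)
                (us : List Tree) (c₀ : List Lit) (Old : Lit → Set)
                (us-lives : ∀ {c x} → c₀ ⊆ c → x ∈ S → Any (Live x (neg l ∷ c)) us → x ≢ l × Old x) where

  mutual
    Graft-lives : ∀ {T T′ co cn x} → Graft l us T T′ → co ⊆ l ∷ cn → c₀ ⊆ cn → AllLabels (_≢ l) T →
                  x ∈ S → Live x cn T′ → x ≢ l × (Live x co T ⊎ Old x)
    Graft-lives (leaf-comp m comp) _ _ _ x∈S (here _) = contradiction comp (pnc l m l∈S x∈S)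
    Graft-lives (leaf-comp m refl) _ c₀⊆ _ x∈S (there lives) with us-lives c₀⊆ x∈S lives
    ... | x≢l , old = x≢l , inj₂ old
    Graft-lives (leaf-other m _) _ _ _ _ (there ())
    Graft-lives {x = x} (inner m _ _ _ _) co⊆ _ (node (Maybe.just x≢l) _) x∈S (here ∉cn) =
      x≢l , inj₁ (here ∉co)
      where
      ∉co : neg x ∉ _
      ∉co ∈co with co⊆ ∈co
      ... | here neg-x≡l = pnc x l x∈S l∈S (sym neg-x≡l)
      ... | there ∈cn    = ∉cn ∈cn
    Graft-lives (inner m _ _ _ grafts) co⊆ c₀⊆ (node _ alls) x∈S (there lives)
      with Grafts-lives grafts (extend-⊆-∷ m co⊆) (λ y∈ → ∈-++⁺ʳ (fromMaybe m) (c₀⊆ y∈)) alls x∈S lives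
    ... | x≢l , inj₁ lives′ = x≢l , inj₁ (there lives′)
    ... | x≢l , inj₂ old    = x≢l , inj₂ old

    Grafts-lives : ∀ {ts ts′ co cn x} → Pointwise (Graft l us) ts ts′ → co ⊆ l ∷ cn → c₀ ⊆ cn →
                   All (AllLabels (_≢ l)) ts → x ∈ S → Any (Live x cn) ts′ →
                   x ≢ l × (Any (Live x co) ts ⊎ Old x)
    Grafts-lives (graft ∷ _) co⊆ c₀⊆ (all ∷ _) x∈S (here live) with Graft-lives graft co⊆ c₀⊆ all x∈S live
    ... | x≢l , inj₁ live′ = x≢l , inj₁ (here live′)
    ... | x≢l , inj₂ old   = x≢l , inj₂ old
    Grafts-lives (_ ∷ grafts) co⊆ c₀⊆ (_ ∷ alls) x∈S (there lives)
      with Grafts-lives grafts co⊆ c₀⊆ alls x∈S lives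
    ... | x≢l , inj₁ lives′ = x≢l , inj₁ (there lives′)
    ... | x≢l , inj₂ old    = x≢l , inj₂ old

module Measure (S : List Lit) where

  level : List Lit → Tree → ℕ
  level c t = length (filter (λ x → ¬? (live? x c t)) S)

  K : ℕ
  K = suc (length S)

  level<K : ∀ c t → level c t < K
  level<K c t = s≤s (length-filter _ S)

  LiveIn : List Lit → Tree → List Lit → Tree → Set
  LiveIn c′ t′ c t = ∀ {x} → x ∈ S → Live x c′ t′ → Live x c t

  level-antitone : ∀ {c t c′ t′} → LiveIn c′ t′ c t → level c t ≤ level c′ t′
  level-antitone ⊆live = length-filter-mono _ _ S (λ x∈S ¬live live′ → ¬live (⊆live x∈S live′))

  level-increase : ∀ {c t c′ t′ z} → LiveIn c′ t′ c t → z ∈ S → Live z c t → ¬ Live z c′ t′ →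
                   level c t < level c′ t′
  level-increase ⊆live z∈S live ¬live′ =
    length-filter-strict _ _ S (λ x∈S ¬live live′ → ¬live (⊆live x∈S live′))
                         z∈S ¬live′ (λ ¬live → ¬live live)

  mutual
    μ : List Lit → Tree → Counts K
    μ c t@(node m cs) = δ (level c t) ⊕ μs (extend m c) cs

    μs : List Lit → List Tree → Counts K
    μs c []       = 0ᶜ
    μs c (t ∷ ts) = μ c t ⊕ μs c ts

  mutual
    μ-zeroBelow : ∀ c t → ZeroBelow (level c t) (μ c t)
    μ-zeroBelow c t@(node m cs) =
      ZeroBelow-⊕ (δ (level c t)) _ (ZeroBelow-δ ≤-refl)
        (μs-zeroBelow (extend m c) cs (λ u∈cs → level-antitone (λ _ live → there (lose u∈cs live))))

    μs-zeroBelow : ∀ {p} c ts → (∀ {u} → u ∈ ts → p ≤ level c u) → ZeroBelow p (μs c ts)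
    μs-zeroBelow c []       _  = ZeroBelow-0ᶜ _
    μs-zeroBelow c (u ∷ us) ≤level =
      ZeroBelow-⊕ (μ c u) _ (ZeroBelow-anti (μ c u) (≤level (here refl)) (μ-zeroBelow c u))
                            (μs-zeroBelow c us (λ u∈ → ≤level (there u∈)))

  0ᶜ<ᶜμ : ∀ c t → 0ᶜ <ᶜ μ c t
  0ᶜ<ᶜμ c t@(node m cs) = <ᶜ-≤ᶜ-trans (0ᶜ<ᶜδ (level<K c t)) (≤ᶜ-⊕ʳ _ _)

  μ≤μs : ∀ {c u ts} → u ∈ ts → μ c u ≤ᶜ μs c ts
  μ≤μs (here refl)               = ≤ᶜ-⊕ʳ _ _
  μ≤μs {ts = t ∷ _} (there u∈ts) = ≤ᶜ-trans (μ≤μs u∈ts) (≤ᶜ-⊕ˡ _ (μ _ t))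

  mutual
    μ-transport : ∀ {Q c c′} → ClosureTransfer Q c c′ → ClosureTransfer Q c′ c →
                  ∀ {t} → AllLabels Q t → μ c t ≡ μ c′ t
    μ-transport tr tr′ all@(node {m = m} _ alls) =
      cong₂ _⊕_ (cong δ (≤-antisym (level-antitone (λ _ → Live-transport tr all))
                                   (level-antitone (λ _ → Live-transport tr′ all))))
                (μs-transport (transfer-extend m tr) (transfer-extend m tr′) alls)

    μs-transport : ∀ {Q c c′} → ClosureTransfer Q c c′ → ClosureTransfer Q c′ c →
                   ∀ {ts} → All (AllLabels Q) ts → μs c ts ≡ μs c′ ts
    μs-transport tr tr′ []           = refl
    μs-transport tr tr′ (all ∷ alls) = cong₂ _⊕_ (μ-transport tr tr′ all) (μs-transport tr tr′ alls)

  infix 4 _⊏⟨_⟩_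
  _⊏⟨_⟩_ : Tree → List Lit → Tree → Set
  t′ ⊏⟨ c ⟩ t = μ c t′ <ᶜ μ c t × LiveIn c t′ c t

  -- losing a live literal raises the level of the root, so μ c t′ vanishes up to and including
  -- the position of the leading unit vector δ (level c t) of μ c t
  ⊏-by-lost-literal : ∀ {c t t′ z} → LiveIn c t′ c t → z ∈ S → Live z c t → ¬ Live z c t′ → t′ ⊏⟨ c ⟩ t
  ⊏-by-lost-literal {c} {t@(node _ _)} {t′} ⊆live z∈S live ¬live′ =
    <ᶜ-≤ᶜ-trans (ZeroBelow⇒<ᶜδ (μ c t′) (level<K c t)
                  (ZeroBelow-anti (μ c t′) (level-increase ⊆live z∈S live ¬live′) (μ-zeroBelow c t′)))
                (≤ᶜ-⊕ʳ _ _)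
    , ⊆live

  LivesIn : List Lit → List Tree → List Tree → Set
  LivesIn c ts′ ts = ∀ {x} → x ∈ S → Any (Live x c) ts′ → Any (Live x c) ts

  LiveIn-children : ∀ {c m cs′ cs u} → u ∈ cs → LivesIn (extend m c) cs′ cs →
                    LiveIn c (node m cs′) c (node m cs)
  LiveIn-children {cs = _ ∷ _} _ _      _   (here ∉c)    = here ∉c
  LiveIn-children              _ ⊆lives x∈S (there live) = there (⊆lives x∈S live)

  ⊏-by-children : ∀ {c m cs′ cs u} → u ∈ cs → LivesIn (extend m c) cs′ cs →
                  μs (extend m c) cs′ <ᶜ μs (extend m c) cs → node m cs′ ⊏⟨ c ⟩ node m cs
  ⊏-by-children u∈cs ⊆lives lt = ⊕-mono-≤-< (δ-antitone (level-antitone ⊆live)) lt , ⊆live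
    where ⊆live = LiveIn-children u∈cs ⊆lives

  leaf-⊏ : ∀ {c m d ds} → node m [] ⊏⟨ c ⟩ node m (d ∷ ds)
  leaf-⊏ {c} {m} {d} {ds} =
    ⊏-by-children (here refl) (λ _ ())
                  (<ᶜ-≤ᶜ-trans (0ᶜ<ᶜμ (extend m c) d) (μ≤μs {ts = d ∷ ds} (here refl)))

  -- replacing a child labelled y by its own children is harmless for the branch whenever
  -- the literals that y closes are already closed above
  contract-⊏ : ∀ {Q c lP cs y ds} i → nth cs i ≡ just (node (just y) ds) →
               (Q (neg y) → y ∈ extend lP c) → All (AllLabels Q) ds → node lP ds ⊏⟨ c ⟩ node lP cs
  contract-⊏ {Q} {c} {lP} {cs} {y} {ds} i eq redundant alls = ⊏-by-children N∈cs ⊆lives lt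
    where
    c₁ = extend lP c
    N∈cs = nth-∈ cs i eq

    widen : ClosureTransfer Q c₁ (y ∷ c₁)
    widen _ = there

    narrow : ClosureTransfer Q (y ∷ c₁) c₁
    narrow _  (there ∈c₁)  = ∈c₁
    narrow {x} qx (here refl) = redundant (subst Q (sym (neg-involutive x)) qx)

    ⊆lives : LivesIn c₁ ds cs
    ⊆lives _ lives = lose N∈cs (there (Lives-transport narrow alls lives))

    lt : μs c₁ ds <ᶜ μs c₁ cs
    lt = <ᶜ-≤ᶜ-trans (subst (_<ᶜ μ c₁ (node (just y) ds)) (sym (μs-transport widen narrow alls))
                       (<ᶜ-⊕ˡ _ (0ᶜ<ᶜδ (level<K c₁ (node (just y) ds)))))
                     (μ≤μs N∈cs)

  updN-⊏ : ∀ {c} cs i {w g} → nth cs i ≡ just w → g w ⊏⟨ c ⟩ w →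
           μs c (updN i g cs) <ᶜ μs c cs × LivesIn c (updN i g cs) cs
  updN-⊏ (t ∷ ts) zero    refl (lt , ⊆live) =
    ⊕-mono-<-≤ lt ≤ᶜ-refl , λ { x∈S (here live) → here (⊆live x∈S live) ; _ (there lives) → there lives }
  updN-⊏ (t ∷ ts) (suc i) eq   t′⊏t with updN-⊏ ts i eq t′⊏t
  ... | lt , ⊆lives =
    ⊕-mono-≤-< ≤ᶜ-refl lt , λ { _ (here live) → here live ; x∈S (there lives) → there (⊆lives x∈S lives) }

  upd-⊏ : ∀ {c} t p {u f} → sub t p ≡ just u → f u ⊏⟨ branch c t p ⟩ u → upd p f t ⊏⟨ c ⟩ t
  upd-⊏ t           []      refl u′⊏u = u′⊏u
  upd-⊏ (node m cs) (i ∷ p) eq   u′⊏u with nth cs i in eqᵢ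
  ... | just w with updN-⊏ cs i eqᵢ (upd-⊏ w p eq u′⊏u)
  ...   | lt , ⊆lives = ⊏-by-children (nth-∈ cs i eqᵢ) ⊆lives lt

module Termination (S : List Lit) (pnc : PairwiseNonComplementary S) where
  open Measure S

  uneager-⊏ : ∀ {t t′} → UneagerStep t t′ → t′ ⊏⟨ [] ⟩ t
  uneager-⊏ {t} (p , _ , _ , _ , eq , _ , refl) = upd-⊏ t p eq leaf-⊏

  irreg-⊏ : ∀ {t t′} → IrregStep t t′ → t′ ⊏⟨ [] ⟩ t
  irreg-⊏ {t} (p , i , lP , cs , lN , ds , (q , y , (_ , _ , eqq) , atq , (_ , atN)) , eq , eqᵢ , refl)
    with trans (sym (sub-child t p i eq eqᵢ)) atN | prefix-of-snoc p q eqq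
  ... | refl | r , refl =
    upd-⊏ t (q ++ r) eq (contract-⊏ {Q = λ _ → ⊤} i eqᵢ (λ _ → ∈-branch⁺ [] t q r atq eq)
                                                        (AllLabels-children ds (λ _ _ _ → tt)))

  conv-closed-⊏ : ∀ {t} p {lP cs i l ds ds′} → Regular t → sub t p ≡ just (node lP cs) →
             nth cs i ≡ just (node (just l) ds) →
             Pointwise (Graft l (updN i (λ _ → node (just l) []) cs)) ds ds′ →
             neg l ∈ extend lP (branch [] t p) → node lP ds′ ⊏⟨ branch [] t p ⟩ node lP cs
  conv-closed-⊏ {t} p {lP} {cs} {i} reg eq eqᵢ grafts closed with ∈-branch⁻ [] t p eq closed
  ... | inj₂ (q , r , refl , atq) =
    subst (λ ds″ → node lP ds″ ⊏⟨ branch [] t p ⟩ node lP cs) (sym (Grafts-identity grafts absent))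
          (contract-⊏ i eqᵢ (λ neg-l≢neg-l → contradiction refl neg-l≢neg-l) absent)
    where
    absent = Regular⇒absent-below q (r ++ i ∷ []) reg atq (++-assoc q r (i ∷ []))
                                  (sub-child t (q ++ r) i eq eqᵢ)

  conv-open-⊏ : ∀ {t} p {lP cs i l d ds ds′} → Regular t → l ∈ S → sub t p ≡ just (node lP cs) →
           nth cs i ≡ just (node (just l) (d ∷ ds)) →
           Pointwise (Graft l (updN i (λ _ → node (just l) []) cs)) (d ∷ ds) ds′ →
           neg l ∉ extend lP (branch [] t p) → node lP ds′ ⊏⟨ branch [] t p ⟩ node lP cs
  conv-open-⊏ {t} p {lP} {cs} {i} {l} {d} {ds} {ds′} reg l∈S eq eqᵢ grafts ¬closed =
    ⊏-by-lost-literal (LiveIn-children N∈cs (λ x∈S lives → proj₂ (new-lives x∈S lives)))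
                      l∈S live-before not-live-after
    where
    c₁   = extend lP (branch [] t p)
    eqN  = sub-child t p i eq eqᵢ
    N∈cs = nth-∈ cs i eqᵢ

    us-lives : ∀ {c x} → c₁ ⊆ c → x ∈ S → Any (Live x (neg l ∷ c)) (updN i (λ _ → node (just l) []) cs) →
               x ≢ l × Any (Live x c₁) cs
    us-lives c₁⊆ _ lives with Any-updN-const⁻ i cs lives
    ... | inj₁ lives′ = (λ { refl → Lives⇒open lives′ (here refl) })
                      , Any.map (Live-antitone (λ y∈ → there (c₁⊆ y∈))) lives′
    ... | inj₂ (there ())

    open Grafting S pnc l∈S (updN i (λ _ → node (just l) []) cs) c₁ (λ x → Any (Live x c₁) cs) us-lives

    new-lives : ∀ {x} → x ∈ S → Any (Live x c₁) ds′ → x ≢ l × Any (Live x c₁) cs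
    new-lives x∈S lives with Grafts-lives grafts (λ y∈ → y∈) (λ y∈ → y∈) no-l-below x∈S lives
      where no-l-below = Regular⇒absent-below (p ++ i ∷ []) [] reg (_ , eqN) (sym (++-identityʳ _)) eqN
    ... | x≢l , inj₁ lives-ds = x≢l , lose N∈cs (there lives-ds)
    ... | x≢l , inj₂ lives-cs = x≢l , lives-cs

    live-before : Live l (branch [] t p) (node lP cs)
    live-before = there (lose N∈cs (here ¬closed))

    not-live-after : ¬ Live l (branch [] t p) (node lP ds′)
    not-live-after (here _)      = reg p (p ++ i ∷ []) l (i , [] , refl) (cs , eq) (d ∷ ds , eqN)
    not-live-after (there lives) = proj₁ (new-lives l∈S lives) refl

  conv-⊏ : ∀ {t t′} → Regular t → ConvStep S t t′ → t′ ⊏⟨ [] ⟩ t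
  conv-⊏ {t} reg (p , i , lP , cs , l , ds , ds′ , ((_ , _ , _ , at-inner) , (_ , (_ , atl) , l∈S) , _) ,
                  eq , eqᵢ , grafts , refl)
    with neg l ∈? extend lP (branch [] t p)
  ... | yes closed = upd-⊏ t p eq (conv-closed-⊏ p reg eq eqᵢ grafts closed)
  ... | no ¬closed
    with trans (sym atl) (sub-child t p i eq eqᵢ) | trans (sym at-inner) (sub-child t p i eq eqᵢ)
  ...   | refl | refl = upd-⊏ t p eq (conv-open-⊏ p reg l∈S eq eqᵢ grafts ¬closed)

  phaseRank : Phase → ℕ
  phaseRank convPhase    = 0
  phaseRank irregPhase   = 1
  phaseRank uneagerPhase = 2

  Invariant : State → Set
  Invariant (convPhase , t) = Regular t
  Invariant _               = ⊤

  measure : State → Counts K × ℕ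
  measure (ph , t) = μ [] t , phaseRank ph

  _<ₘ_ : State → State → Set
  s′ <ₘ s = ×-Lex _≡_ _<ᶜ_ _<_ (measure s′) (measure s)

  step-decreases : ∀ {s s′} → Invariant s → Step S s s′ → Invariant s′ × s′ <ₘ s
  step-decreases reg (conv _ _ step)    = tt , inj₁ (proj₁ (conv-⊏ reg step))
  step-decreases _   (uneager _ _ step) = tt , inj₁ (proj₁ (uneager-⊏ step))
  step-decreases _   (uneagerOk _ _)    = tt , inj₂ (refl , s≤s (s≤s z≤n))
  step-decreases _   (irreg _ _ step)   = tt , inj₁ (proj₁ (irreg-⊏ step))
  step-decreases _   (irregOk _ reg)    = reg , inj₂ (refl , s≤s z≤n)

  terminates : ∀ s → Invariant s → Acc (×-Lex _≡_ _<ᶜ_ _<_) (measure s) → Terminates S s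
  terminates s inv (acc smaller) = acc λ step → let inv′ , lt = step-decreases inv step in
                                                 terminates _ inv′ (smaller lt)

proposition11 : (C : ClausalFormula) (t : Tree) (S : List Lit) →
    ClausalTableau C t → ClosedTableau t → Eager t → Regular t →
    PairwiseNonComplementary S → OccurIn S t →
    Terminates S (convPhase , t)
-- termination needs only regularity of t and pairwise non-complementarity of S
proposition11 C t S _ _ _ reg pnc _ =
  Termination.terminates S pnc (convPhase , t) reg (×-wellFounded <ᶜ-wellFounded <-wellFounded _)
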